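{- For all $f,g:(\mathbb N\to\mathbb N)\to\mathbb N$, there is a map which, given Diophantine witnesses for $f$ and $g$, produces a Diophantine witness for the relation $\nu\mapsto f\nu\nmid g\nu$.
   Context: Here $u\nmid v$ means $\neg\exists k,\ v=k\,u$. Diophantine logic formulas are $A,B::= x_i\doteq n\mid x_i\doteq x_j\mid x_i\doteq x_j\dot+x_k\mid x_i\doteq x_j\dot\times x_k\mid A\dot\wedge B\mid A\dot\vee B\mid\dot\exists A$ (De Bruijn indices). For a valuation $\nu:\mathbb N\to\mathbb N$ the semantics is as follows. - Atoms have their obvious meaning. - $\dot\wedge$ and $\dot\vee$ are interpreted as $\wedge$ and $\vee$. - $[\![\dot\exists A]\!]\nu\iff\exists n,\ [\![A]\!](n\cdot\nu)$, with $(n\cdot\nu)(0)=n$ and $(n\cdot\nu)(i+1)=\nu(i)$. A Diophantine witness for a relation $S$ on valuations is a formula $A$ with $[\![A]\!]\nu\leftrightarrow S\,\nu$ for all $\nu$. A Diophantine witness for $f:(\mathbb N\to\mathbb N)\to\mathbb N$ is one for the relation $\nu\mapsto\nu(0)=f(\uparrow\nu)$, where $(\uparrow\nu)(i)=\nu(i+1)$. -}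

module Defs where

open import Data.Nat using (ℕ; zero; suc; _+_; _*_)
open import Data.Product using (Σ; ∃; _×_)
open import Data.Sum using (_⊎_)
open import Relation.Binary.PropositionalEquality using (_≡_)

-- Diophantine logic formulas, variables as De Bruijn indices
data DioForm : Set where
  _≐c_   : ℕ → ℕ → DioForm
  _≐v_   : ℕ → ℕ → DioForm
  _≐_⊹_  : ℕ → ℕ → ℕ → DioForm
  _≐_⊗_  : ℕ → ℕ → ℕ → DioForm
  _∧̇_    : DioForm → DioForm → DioForm
  _∨̇_    : DioForm → DioForm → DioForm
  ∃̇_     : DioForm → DioForm

Val : Set
Val = ℕ → ℕ

_·_ : ℕ → Val → Val
(n · ν) zero    = n
(n · ν) (suc i) = ν i

↑ : Val → Val
↑ ν i = ν (suc i)

⟦_⟧ : DioForm → Val → Set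
⟦ i ≐c n ⟧      ν = ν i ≡ n
⟦ i ≐v j ⟧      ν = ν i ≡ ν j
⟦ i ≐ j ⊹ k ⟧   ν = ν i ≡ ν j + ν k
⟦ i ≐ j ⊗ k ⟧   ν = ν i ≡ ν j * ν k
⟦ A ∧̇ B ⟧       ν = ⟦ A ⟧ ν × ⟦ B ⟧ ν
⟦ A ∨̇ B ⟧       ν = ⟦ A ⟧ ν ⊎ ⟦ B ⟧ ν
⟦ ∃̇ A ⟧         ν = ∃ λ n → ⟦ A ⟧ (n · ν)

DioWitnessRel : (Val → Set) → DioForm → Set
DioWitnessRel S A = ∀ ν → (⟦ A ⟧ ν → S ν) × (S ν → ⟦ A ⟧ ν)

DioRel : (Val → Set) → Set
DioRel S = Σ DioForm (DioWitnessRel S)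

DioFun : (Val → ℕ) → Set
DioFun f = DioRel (λ ν → ν 0 ≡ f (↑ ν))

-- Introduce variables x and y for the values f ν and g ν: then f ν ∤ g ν holds iff
-- some x, y satisfy x = f ν, y = g ν and x ∤ y. The first two conjuncts are the given
-- witnesses with their variables renamed, and x ∤ y is Diophantine because it says
-- that either x = 0 < y, or y = q x + r with 0 < r < x.
module Submission where

open import Data.Nat using (ℕ; zero; suc; _+_; _*_; _<_; NonZero; ≢-nonZero; z<s)
open import Data.Nat.Properties using (_≟_; +-comm; 1+n≢0; m≤m+n; m≤n⇒∃[o]m+o≡n)
open import Data.Nat.Divisibility using (_∤_; divides; ∣m+n∣m⇒∣n; n∣m*n; >⇒∤; 0∣⇒≡0; m%n≡0⇒n∣m)
open import Data.Nat.DivMod using (_%_; _/_; m≡m%n+[m/n]*n; m%n<n)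
open import Data.Product using (∃; ∃₂; _×_; _,_; proj₁; proj₂; map₂)
open import Data.Product.Function.NonDependent.Propositional using (_×-⇔_)
open import Data.Sum using (inj₁; inj₂)
open import Data.Sum.Function.Propositional using (_⊎-⇔_)
open import Data.Empty using (⊥-elim)
open import Function using (_∘_; _⇔_; mk⇔; Equivalence)
open import Function.Construct.Composition using (_⇔-∘_)
open import Relation.Binary.PropositionalEquality using (_≡_; refl; sym; cong; cong₂; subst; subst₂; module ≡-Reasoning)
open import Relation.Nullary using (yes; no)
open import Defs

open Equivalence using (to; from)

ext : (ℕ → ℕ) → ℕ → ℕ
ext ρ zero    = zero
ext ρ (suc i) = suc (ρ i)

rename : (ℕ → ℕ) → DioForm → DioForm
rename ρ (i ≐c n)    = ρ i ≐c n
rename ρ (i ≐v j)    = ρ i ≐v ρ j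
rename ρ (i ≐ j ⊹ k) = ρ i ≐ ρ j ⊹ ρ k
rename ρ (i ≐ j ⊗ k) = ρ i ≐ ρ j ⊗ ρ k
rename ρ (A ∧̇ B)     = rename ρ A ∧̇ rename ρ B
rename ρ (A ∨̇ B)     = rename ρ A ∨̇ rename ρ B
rename ρ (∃̇ A)       = ∃̇ rename (ext ρ) A

∃-⇔ : ∀ {P Q : ℕ → Set} → (∀ n → P n ⇔ Q n) → (∃ P) ⇔ (∃ Q)
∃-⇔ e = mk⇔ (map₂ (to (e _))) (map₂ (from (e _)))

≡-⇔ : ∀ {a b c d : ℕ} → a ≡ c → b ≡ d → (a ≡ b) ⇔ (c ≡ d)
≡-⇔ refl refl = mk⇔ (λ e → e) (λ e → e)

rename-⇔ : ∀ A {ρ ν μ} → (∀ i → ν (ρ i) ≡ μ i) → ⟦ rename ρ A ⟧ ν ⇔ ⟦ A ⟧ μ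
rename-⇔ (i ≐c n)    h = ≡-⇔ (h i) refl
rename-⇔ (i ≐v j)    h = ≡-⇔ (h i) (h j)
rename-⇔ (i ≐ j ⊹ k) h = ≡-⇔ (h i) (cong₂ _+_ (h j) (h k))
rename-⇔ (i ≐ j ⊗ k) h = ≡-⇔ (h i) (cong₂ _*_ (h j) (h k))
rename-⇔ (A ∧̇ B) h = rename-⇔ A h ×-⇔ rename-⇔ B h
rename-⇔ (A ∨̇ B) h = rename-⇔ A h ⊎-⇔ rename-⇔ B h
rename-⇔ (∃̇ A) {ρ} {ν} {μ} h = ∃-⇔ λ n → rename-⇔ A (h-ext n)
  where
  h-ext : ∀ n i → (n · ν) (ext ρ i) ≡ (n · μ) i
  h-ext n zero    = refl
  h-ext n (suc i) = h i

witness-⇔ : ∀ {S A} → DioWitnessRel S A → ∀ ν → ⟦ A ⟧ ν ⇔ S ν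
witness-⇔ w ν = mk⇔ (proj₁ (w ν)) (proj₂ (w ν))

dio : ∀ {S} A → (∀ ν → ⟦ A ⟧ ν ⇔ S ν) → DioRel S
dio A e = A , λ ν → to (e ν) , from (e ν)

DioRel-⇔ : ∀ {R S} → (∀ ν → R ν ⇔ S ν) → DioRel R → DioRel S
DioRel-⇔ R⇔S (A , w) = dio A λ ν → R⇔S ν ⇔-∘ witness-⇔ w ν

DioRel-rename : ∀ {R} (ρ : ℕ → ℕ) → DioRel R → DioRel (λ ν → R (ν ∘ ρ))
DioRel-rename ρ (A , w) = dio (rename ρ A) λ ν → witness-⇔ w (ν ∘ ρ) ⇔-∘ rename-⇔ A (λ _ → refl)

DioRel-× : ∀ {R S} → DioRel R → DioRel S → DioRel (λ ν → R ν × S ν)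
DioRel-× (A , v) (B , w) = dio (A ∧̇ B) λ ν → witness-⇔ v ν ×-⇔ witness-⇔ w ν

DioRel-∃ : ∀ {R} → DioRel R → DioRel (λ ν → ∃ λ n → R (n · ν))
DioRel-∃ (A , w) = dio (∃̇ A) λ ν → ∃-⇔ λ n → witness-⇔ w (n · ν)

0∤⇒≡suc : ∀ {y} → 0 ∤ y → ∃ λ k → y ≡ suc k
0∤⇒≡suc {zero}  0∤0 = ⊥-elim (0∤0 (divides 0 refl))
0∤⇒≡suc {suc k} _   = k , refl

0∤suc : ∀ {k} → 0 ∤ suc k
0∤suc = 1+n≢0 ∘ 0∣⇒≡0

remainder⇒∤ : ∀ {x q r} → 0 < r → r < x → x ∤ q * x + r
remainder⇒∤ {x} {q} {suc _} _ r<x x∣y = >⇒∤ r<x (∣m+n∣m⇒∣n x∣y (n∣m*n q))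

∤⇒remainder : ∀ {x y} .{{_ : NonZero x}} → x ∤ y → ∃₂ λ q r → 0 < r × r < x × y ≡ q * x + r
∤⇒remainder {x} {y} x∤y with y % x in y%x≡r | m%n<n y x
... | zero  | _   = ⊥-elim (x∤y (m%n≡0⇒n∣m y x y%x≡r))
... | suc r | r<x = y / x , suc r , z<s , r<x , (begin
  y                   ≡⟨ m≡m%n+[m/n]*n y x ⟩
  y % x + y / x * x   ≡⟨ cong (_+ y / x * x) y%x≡r ⟩
  suc r + y / x * x   ≡⟨ +-comm (suc r) _ ⟩
  y / x * x + suc r   ∎)
  where open ≡-Reasoning

-- Both formulas are read with x = ν 0 and y = ν 1; the constant 1 needs a variable c
-- of its own, and sums are ordered c + _ so that c + n reduces to suc n.
zero-divisor : DioForm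
zero-divisor = ∃̇ ∃̇ ((0 ≐c 1) ∧̇ ((2 ≐c 0) ∧̇ (3 ≐ 0 ⊹ 1)))

-- with variables q r s r' t p c: r = 1 + s, r' = 1 + r, x = r' + t, y = q x + r
nonzero-remainder : DioForm
nonzero-remainder = ∃̇ ∃̇ ∃̇ ∃̇ ∃̇ ∃̇ ∃̇
  ((0 ≐c 1) ∧̇ ((5 ≐ 0 ⊹ 4) ∧̇ ((3 ≐ 0 ⊹ 5) ∧̇ ((7 ≐ 3 ⊹ 2) ∧̇ ((1 ≐ 6 ⊗ 7) ∧̇ (8 ≐ 1 ⊹ 5))))))

∤-formula : DioForm
∤-formula = zero-divisor ∨̇ nonzero-remainder

∤-formula-sound : ∀ ν → ⟦ ∤-formula ⟧ ν → ν 0 ∤ ν 1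
∤-formula-sound ν (inj₁ (_ , _ , refl , x≡0 , y≡1+k)) =
  subst₂ _∤_ (sym x≡0) (sym y≡1+k) 0∤suc
∤-formula-sound ν (inj₂ (q , _ , s , _ , t , _ , _ , refl , refl , refl , x≡2+s+t , refl , y≡qx+r)) =
  subst (ν 0 ∤_) (sym y≡qx+r) (remainder⇒∤ {q = q} z<s r<x)
  where
  r<x : suc s < ν 0
  r<x = subst (suc s <_) (sym x≡2+s+t) (m≤m+n (suc (suc s)) t)

∤-formula-complete : ∀ ν → ν 0 ∤ ν 1 → ⟦ ∤-formula ⟧ ν
∤-formula-complete ν x∤y with ν 0 ≟ 0
... | yes x≡0 with 0∤⇒≡suc (subst (_∤ ν 1) x≡0 x∤y)
...   | k , y≡1+k = inj₁ (k , 1 , refl , x≡0 , y≡1+k)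
∤-formula-complete ν x∤y | no x≢0
  with ∤⇒remainder {{≢-nonZero x≢0}} x∤y
... | q , suc s , _ , r<x , y≡qx+r with m≤n⇒∃[o]m+o≡n r<x
...   | t , 2+s+t≡x =
  inj₂ (q , suc s , s , suc (suc s) , t , q * ν 0 , 1 , refl , refl , refl , sym 2+s+t≡x , refl , y≡qx+r)

DioRel-∤ : DioRel (λ ν → ν 0 ∤ ν 1)
DioRel-∤ = ∤-formula , λ ν → ∤-formula-sound ν , ∤-formula-complete ν

-- For a function witness used under two fresh variables: its output becomes variable k,
-- and ↑ (ν ∘ output-at k) is definitionally the valuation below the fresh variables.
output-at : ℕ → ℕ → ℕ
output-at k zero    = k
output-at k (suc i) = suc (suc i)

proposition2p6 : (f g : Val → ℕ) → DioFun f → DioFun g → DioRel (λ ν → f ν ∤ g ν)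
proposition2p6 f g F G = DioRel-⇔ introduce-values
  (DioRel-∃ (DioRel-∃ (DioRel-× (DioRel-× (DioRel-rename (output-at 0) F)
                                          (DioRel-rename (output-at 1) G))
                                DioRel-∤)))
  where
  introduce-values : ∀ ν → (∃ λ y → ∃ λ x → (x ≡ f ν × y ≡ g ν) × x ∤ y) ⇔ f ν ∤ g ν
  introduce-values ν = mk⇔ (λ { (_ , _ , (refl , refl) , x∤y) → x∤y })
                           (λ fν∤gν → g ν , f ν , (refl , refl) , fν∤gν)
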